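{- Every formula of $\mathcal L$ that is classically satisfiable is satisfiable in some intuitionistic dynamic model. However, there is a formula of $\mathcal L$ that is satisfiable in some intuitionistic dynamic model but is not classically satisfiable.
   Context: Formulas of $\mathcal L$: $\varphi::= p\mid\bot\mid\varphi\wedge\varphi\mid\varphi\vee\varphi\mid\varphi\to\varphi\mid\bigcirc\varphi\mid\Diamond\varphi\mid\Box\varphi$, $p$ in a countable set $\mathbb P$ of variables; $\neg\varphi:=\varphi\to\bot$. A dynamic poset is $(W,\preccurlyeq,S)$ with $W\neq\emptyset$, $\preccurlyeq$ a partial order on $W$, and $S\colon W\to W$ such that $w\preccurlyeq v$ implies $S(w)\preccurlyeq S(v)$. An intuitionistic dynamic model is $(W,\preccurlyeq,S,V)$ with $(W,\preccurlyeq,S)$ a dynamic poset and $V\colon W\to2^{\mathbb P}$ with $w\preccurlyeq v\Rightarrow V(w)\subseteq V(v)$. With $S^0(w)=w$, $S^{k+1}(w)=S(S^k(w))$, satisfaction is: $w\models p$ iff $p\in V(w)$; $\bot$ never; $\wedge,\vee$ as usual; $w\models\varphi\to\psi$ iff for all $v\succcurlyeq w$, $v\models\varphi$ implies $v\models\psi$; $w\models\bigcirc\varphi$ iff $S(w)\models\varphi$; $w\models\Diamond\varphi$ iff $S^k(w)\models\varphi$ for some $k\ge0$; $w\models\Box\varphi$ iff $S^k(w)\models\varphi$ for all $k\ge0$. A formula is satisfiable in a model if it holds at some world. A formula is classically satisfiable if it is true at some world of some classical model $(W,S,V)$ ($W\ne\emptyset$, $S\colon W\to W$ any function, $V\colon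 W\to 2^{\mathbb P}$), where classical satisfaction is defined by the same clauses except that $\varphi\to\psi$ holds at $w$ iff $\varphi$ fails at $w$ or $\psi$ holds at $w$ (equivalently, the clauses above with $\preccurlyeq$ the identity relation). -}

module Defs where

open import Data.Nat using (ℕ; zero; suc)
open import Data.Product using (Σ; _×_; ∃)
open import Data.Sum using (_⊎_)
open import Data.Empty using (⊥)
open import Relation.Nullary using (¬_)
open import Relation.Binary.PropositionalEquality using (_≡_)

-- Formulas of L; propositional variables are indexed by ℕ (countable set P).
data Form : Set where
  var  : ℕ → Form
  ⊥f   : Form
  _∧f_ : Form → Form → Form
  _∨f_ : Form → Form → Form
  _⇒f_ : Form → Form → Form
  ○f   : Form → Form
  ◇f   : Form → Form
  □f   : Form → Form

¬f : Form → Form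
¬f φ = φ ⇒f ⊥f

iter : {W : Set} → (W → W) → ℕ → W → W
iter S zero    w = w
iter S (suc k) w = S (iter S k w)

-- Intuitionistic dynamic model (W, ≼, S, V); W nonempty, ≼ partial order,
-- S monotone, V monotone.  V w p means p ∈ V(w).
record IDM : Set₁ where
  field
    W       : Set
    inhabited : W
    _≼_     : W → W → Set
    ≼-refl  : ∀ w → w ≼ w
    ≼-trans : ∀ {u v w} → u ≼ v → v ≼ w → u ≼ w
    ≼-antisym : ∀ {u v} → u ≼ v → v ≼ u → u ≡ v
    S       : W → W
    S-mono  : ∀ {w v} → w ≼ v → S w ≼ S v
    V       : W → ℕ → Set
    V-mono  : ∀ {w v} p → w ≼ v → V w p → V v p

module _ (M : IDM) where
  open IDM M
  _⊨_ : W → Form → Set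
  w ⊨ var p    = V w p
  w ⊨ ⊥f       = ⊥
  w ⊨ (φ ∧f ψ) = (w ⊨ φ) × (w ⊨ ψ)
  w ⊨ (φ ∨f ψ) = (w ⊨ φ) ⊎ (w ⊨ ψ)
  w ⊨ (φ ⇒f ψ) = ∀ v → w ≼ v → v ⊨ φ → v ⊨ ψ
  w ⊨ ○f φ     = S w ⊨ φ
  w ⊨ ◇f φ     = Σ ℕ (λ k → iter S k w ⊨ φ)
  w ⊨ □f φ     = ∀ k → iter S k w ⊨ φ

IntSat : Form → Set₁
IntSat φ = Σ IDM (λ M → Σ (IDM.W M) (λ w → _⊨_ M w φ))

record CM : Set₁ where
  field
    W  : Set
    inhabited : W
    S  : W → W
    V  : W → ℕ → Set

module _ (M : CM) where
  open CM M
  -- classical satisfaction: the same clauses as above with ≼ the identity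
  -- relation (the paper's stated equivalent form), so φ → ψ holds at w iff
  -- (w ⊨ φ implies w ⊨ ψ).
  _⊨c_ : W → Form → Set
  w ⊨c var p    = V w p
  w ⊨c ⊥f       = ⊥
  w ⊨c (φ ∧f ψ) = (w ⊨c φ) × (w ⊨c ψ)
  w ⊨c (φ ∨f ψ) = (w ⊨c φ) ⊎ (w ⊨c ψ)
  w ⊨c (φ ⇒f ψ) = w ⊨c φ → w ⊨c ψ
  w ⊨c ○f φ     = S w ⊨c φ
  w ⊨c ◇f φ     = Σ ℕ (λ k → iter S k w ⊨c φ)
  w ⊨c □f φ     = ∀ k → iter S k w ⊨c φ

ClSat : Form → Set₁
ClSat φ = Σ CM (λ M → Σ (CM.W M) (λ w → _⊨c_ M w φ))

-- A
--     classical model (W, S, V) is an intuitionistic dynamic model once W is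
--     ordered discretely (≼ is equality); monotonicity of S and V is then
--     trivial, and since the only ≼-successor of w is w itself, the
--     intuitionistic clause for → collapses to the classical one.  Hence the
--     two satisfaction relations coincide on every formula (proved by a
--     mutual induction, both directions being needed for the antecedent of
--     an implication).
--
-- Classically ¬ψ ∧ ¬¬ψ is never true, whatever ψ.
--     Intuitionistically ¬○p ∧ ¬○¬p holds at the top of the two-point chain
--     bot ≺ top, where S sends both points to bot, p is false at bot and
--     true at top: the successor bot falsifies p, yet does not force ¬p,
--     because top lies above it and satisfies p.
module Submission where

open import Defs
open import Data.Product using (_×_; Σ; _,_)
open import Data.Sum using (inj₁; inj₂)
open import Data.Empty using (⊥)
open import Data.Unit using (⊤; tt)
open import Data.Nat using (ℕ)
open import Relation.Nullary using (¬_)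
open import Relation.Binary.PropositionalEquality using (_≡_; refl; trans)

discrete : CM → IDM
discrete M = record
  { W         = CM.W M
  ; inhabited = CM.inhabited M
  ; _≼_       = _≡_
  ; ≼-refl    = λ _ → refl
  ; ≼-trans   = trans
  ; ≼-antisym = λ w≡v _ → w≡v
  ; S         = CM.S M
  ; S-mono    = λ { refl → refl }
  ; V         = CM.V M
  ; V-mono    = λ { _ refl x → x }
  }

module DiscreteAgreement (M : CM) where

  mutual
    discrete⇒classical : ∀ w φ → _⊨_ (discrete M) w φ → _⊨c_ M w φ
    discrete⇒classical w (var p)  h        = h
    discrete⇒classical w ⊥f       h        = h
    discrete⇒classical w (φ ∧f ψ) (a , b)  = discrete⇒classical w φ a , discrete⇒classical w ψ b
    discrete⇒classical w (φ ∨f ψ) (inj₁ a) = inj₁ (discrete⇒classical w φ a)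
    discrete⇒classical w (φ ∨f ψ) (inj₂ b) = inj₂ (discrete⇒classical w ψ b)
    discrete⇒classical w (φ ⇒f ψ) h a      =
      discrete⇒classical w ψ (h w refl (classical⇒discrete w φ a))
    discrete⇒classical w (○f φ)   h        = discrete⇒classical (CM.S M w) φ h
    discrete⇒classical w (◇f φ)   (k , h)  = k , discrete⇒classical _ φ h
    discrete⇒classical w (□f φ)   h k      = discrete⇒classical _ φ (h k)

    classical⇒discrete : ∀ w φ → _⊨c_ M w φ → _⊨_ (discrete M) w φ
    classical⇒discrete w (var p)  h           = h
    classical⇒discrete w ⊥f       h           = h
    classical⇒discrete w (φ ∧f ψ) (a , b)     = classical⇒discrete w φ a , classical⇒discrete w ψ b
    classical⇒discrete w (φ ∨f ψ) (inj₁ a)    = inj₁ (classical⇒discrete w φ a)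
    classical⇒discrete w (φ ∨f ψ) (inj₂ b)    = inj₂ (classical⇒discrete w ψ b)
    -- the only successor of w in the discrete order is w itself
    classical⇒discrete w (φ ⇒f ψ) h .w refl a =
      classical⇒discrete w ψ (h (discrete⇒classical w φ a))
    classical⇒discrete w (○f φ)   h           = classical⇒discrete (CM.S M w) φ h
    classical⇒discrete w (◇f φ)   (k , h)     = k , classical⇒discrete _ φ h
    classical⇒discrete w (□f φ)   h k         = classical⇒discrete _ φ (h k)

open DiscreteAgreement using (classical⇒discrete)

classical⇒intuitionistic : (φ : Form) → ClSat φ → IntSat φ
classical⇒intuitionistic φ (M , w , w⊨φ) = discrete M , w , classical⇒discrete M w φ w⊨φ

¬ψ∧¬¬ψ-classically-false : (M : CM) (w : CM.W M) (ψ : Form) →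
                           ¬ (_⊨c_ M w (¬f ψ ∧f ¬f (¬f ψ)))
¬ψ∧¬¬ψ-classically-false M w ψ (¬ψ , ¬¬ψ) = ¬¬ψ ¬ψ

undecidedNext : Form
undecidedNext = ¬f (○f (var 0)) ∧f ¬f (○f (¬f (var 0)))

data Chain : Set where
  bot top : Chain

data _≤_ : Chain → Chain → Set where
  bot≤bot : bot ≤ bot
  top≤top : top ≤ top
  bot≤top : bot ≤ top

≤-refl : ∀ x → x ≤ x
≤-refl bot = bot≤bot
≤-refl top = top≤top

≤-trans : ∀ {x y z} → x ≤ y → y ≤ z → x ≤ z
≤-trans bot≤bot y≤z     = y≤z
≤-trans top≤top y≤z     = y≤z
≤-trans bot≤top top≤top = bot≤top

≤-antisym : ∀ {x y} → x ≤ y → y ≤ x → x ≡ y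
≤-antisym bot≤bot _ = refl
≤-antisym top≤top _ = refl
≤-antisym bot≤top ()

atTop : Chain → ℕ → Set
atTop bot _ = ⊥
atTop top _ = ⊤

atTop-mono : ∀ {x y} p → x ≤ y → atTop x p → atTop y p
atTop-mono p bot≤bot h = h
atTop-mono p top≤top h = h
atTop-mono p bot≤top _ = tt

chainModel : IDM
chainModel = record
  { W = Chain ; inhabited = top
  ; _≼_ = _≤_ ; ≼-refl = ≤-refl ; ≼-trans = ≤-trans ; ≼-antisym = ≤-antisym
  ; S = λ _ → bot ; S-mono = λ _ → bot≤bot
  ; V = atTop ; V-mono = atTop-mono
  }

-- At top: ○p fails since p fails at bot, and ○¬p fails since top ≥ bot
-- satisfies p.  Top has no proper successors, so both negations hold there.
top⊨undecidedNext : _⊨_ chainModel top undecidedNext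
top⊨undecidedNext = not-next-p , not-next-¬p
  where
    not-next-p : _⊨_ chainModel top (¬f (○f (var 0)))
    not-next-p .top top≤top bot⊨p = bot⊨p

    not-next-¬p : _⊨_ chainModel top (¬f (○f (¬f (var 0))))
    not-next-¬p .top top≤top bot⊨¬p = bot⊨¬p top bot≤top tt

intuitionistic-not-classical : Σ Form (λ φ → IntSat φ × ¬ ClSat φ)
intuitionistic-not-classical =
  undecidedNext ,
  (chainModel , top , top⊨undecidedNext) ,
  λ { (M , w , w⊨φ) → ¬ψ∧¬¬ψ-classically-false M w (○f (var 0)) w⊨φ }

lemma2 : ((φ : Form) → ClSat φ → IntSat φ)
         × Σ Form (λ φ → IntSat φ × ¬ ClSat φ)
lemma2 = classical⇒intuitionistic , intuitionistic-not-classical
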